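{- Let $G=(V,E)$ be a graph, with vertices ordered so that $d(u)\le d(v)$ whenever $u<v$. For any marking vector $X\in\{0,1\}^V$, let $I_X$ be the set of vertices $w$ with $X(w)=1$ such that no neighbor $u>w$ of $w$ has $X(u)=1$ (the independent set returned by FIND-IS with marking $X$). Then $H(I_X)\ge S(X)/2$.
   Context: $d(v)$ is the degree of $v$, $N(v)$ its neighborhood. FIND-IS marks vertices according to $X$ and, for every edge with both endpoints marked, unmarks the endpoint lower in the ordering; the remaining marked vertices form $I_X$. For an independent set $I$, $H(I)$ is the number of edges having at least one endpoint in $I\cup N(I)$ (the edges deleted when forming the residual graph). For each vertex $v$ let $G(v)=\sum_{w\in N(v)}1/d(w)$ and $a_v=\min(1,1/G(v))$; define $$S(v,X)=a_v\sum_{w\in N(v)}X(w)-a_v^2\sum_{\substack{w<w'\\ w,w'\in N(v)}}X(w)X(w')-a_v\sum_{\substack{w\in N(v),\ (w,u)\in E\\ w<u}}X(w)X(u),$$ and $S(X)=\sum_v d(v)S(v,X)$. -}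

module Defs where

open import Data.Bool using (Bool; true; false; if_then_else_; _∧_; _∨_; not)
open import Data.Nat as ℕ using (ℕ; _<ᵇ_)
open import Data.Fin using (Fin; toℕ; _<_)
open import Data.List using (List; foldr; allFin)
open import Data.Bool.ListAction using (any)
open import Data.Integer using (+_)
open import Data.Rational using (ℚ; 0ℚ; 1ℚ; _+_; _-_; _*_; _⊓_; 1/_; _/_; ≢-nonZero)
open import Data.Rational.Properties using (_≟_)
open import Relation.Nullary using (yes; no)
open import Relation.Binary.PropositionalEquality using (_≡_)

record SimpleGraph (n : ℕ) : Set where
  field
    adj   : Fin n → Fin n → Bool
    sym   : ∀ u v → adj u v ≡ adj v u
    irrfl : ∀ v → adj v v ≡ false
open SimpleGraph public

Σℕ : ∀ {n} → (Fin n → ℕ) → ℕ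
Σℕ {n} f = foldr (λ i acc → f i ℕ.+ acc) 0 (allFin n)

Σℚ : ∀ {n} → (Fin n → ℚ) → ℚ
Σℚ {n} f = foldr (λ i acc → f i + acc) 0ℚ (allFin n)

b2ℕ : Bool → ℕ
b2ℕ true  = 1
b2ℕ false = 0

ℕ→ℚ : ℕ → ℚ
ℕ→ℚ k = (+ k) / 1

b2ℚ : Bool → ℚ
b2ℚ b = ℕ→ℚ (b2ℕ b)

_<ᵛ_ : ∀ {n} → Fin n → Fin n → Bool
u <ᵛ v = toℕ u <ᵇ toℕ v

module _ {n : ℕ} (Γ : SimpleGraph n) where

  deg : Fin n → ℕ
  deg v = Σℕ (λ w → b2ℕ (adj Γ v w))

  -- 1/d(w) (only used for neighbours w, which have d(w) ≥ 1)
  invDeg : Fin n → ℚ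
  invDeg w with deg w
  ... | ℕ.zero  = 0ℚ
  ... | ℕ.suc k = (+ 1) / ℕ.suc k

  Gsum : Fin n → ℚ
  Gsum v = Σℚ (λ w → if adj Γ v w then invDeg w else 0ℚ)

  -- a_v = min(1, 1/G(v)); for G(v) = 0 (isolated v) we read 1/0 = ∞, so a_v = 1
  aCoef : Fin n → ℚ
  aCoef v with Gsum v ≟ 0ℚ
  ... | yes _ = 1ℚ
  ... | no  p = 1ℚ ⊓ (1/_ (Gsum v) {{≢-nonZero p}})

  Sv : (Fin n → Bool) → Fin n → ℚ
  Sv X v =
      a * Σℚ (λ w → if adj Γ v w then b2ℚ (X w) else 0ℚ)
    - (a * a) * Σℚ (λ w → Σℚ (λ w' →
          if adj Γ v w ∧ adj Γ v w' ∧ (w <ᵛ w') then b2ℚ (X w ∧ X w') else 0ℚ))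
    - a * Σℚ (λ w → Σℚ (λ u →
          if adj Γ v w ∧ adj Γ w u ∧ (w <ᵛ u) then b2ℚ (X w ∧ X u) else 0ℚ))
    where a = aCoef v

  S : (Fin n → Bool) → ℚ
  S X = Σℚ (λ v → ℕ→ℚ (deg v) * Sv X v)

  inIX : (Fin n → Bool) → Fin n → Bool
  inIX X w = X w ∧ not (any (λ u → adj Γ w u ∧ (w <ᵛ u) ∧ X u) (allFin n))

  inIN : (Fin n → Bool) → Fin n → Bool
  inIN I v = I v ∨ any (λ u → adj Γ v u ∧ I u) (allFin n)

  H : (Fin n → Bool) → ℕ
  H I = Σℕ (λ u → Σℕ (λ v →
          b2ℕ (adj Γ u v ∧ (u <ᵛ v) ∧ (inIN I u ∨ inIN I v))))

module Submission where

-- Fix v, write I = I_X, a = a_v, and let j be the number of neighbours of v in I.  A marked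
-- neighbour w of v is either in I or has a marked neighbour u > w, so the first sum in S(v,X) is
-- at most j plus the third; and neighbours of v in I are marked, so the middle sum is at least
-- j(j-1)/2.  Hence S(v,X) ≤ a j - a^2 j(j-1)/2, which is ≤ 0 if j = 0 and ≤ 1 for 0 ≤ a ≤ 1.
-- Thus S(v,X) ≤ [v has a neighbour in I], and summing d(v) times this counts every edge meeting
-- I ∪ N(I) at most twice: S(X) ≤ 2 H(I).  Neither the degree ordering nor the value of a_v beyond
-- 0 ≤ a_v ≤ 1 is needed.

open import Defs hiding (sym)
open import Data.Bool using (Bool)
open import Data.Nat using (ℕ)
open import Data.Fin using (Fin; _<_)
open import Data.Rational using (_*_; _≤_; ½)

open import Algebra.Bundles using (Ring)
import Algebra.Properties.Semiring.Sum as SemiringSum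
import Algebra.Solver.CommutativeMonoid as CommutativeMonoidSolver
open import Data.Bool using (true; false; _∧_; _∨_; T; if_then_else_)
open import Data.Bool.ListAction using (any)
open import Data.Bool.Properties
  using (∧-assoc; ∧-zeroʳ; ∧-identityʳ; ∨-zeroʳ; ∧-commutativeMonoid; T-∧; T-∨; T-≡)
open import Data.Empty using (⊥-elim)
open import Data.Fin using (toℕ) renaming (zero to fzero; suc to fsuc)
import Data.Fin.Properties as Fin
open import Data.Integer as ℤ using (+_)
import Data.Integer.Properties as ℤ
open import Data.List as List using (allFin)
open import Data.List.Membership.Propositional using (lose)
open import Data.List.Membership.Propositional.Properties using (∈-allFin)
open import Data.List.Relation.Unary.Any using (satisfied)
open import Data.List.Relation.Unary.Any.Properties using (any⁺; any⁻)
import Data.Nat as ℕ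
import Data.Nat.Coprimality as Coprimality
import Data.Nat.Properties as ℕ
open import Data.Nat.Tactic.RingSolver using (solve-∀)
open import Data.Product using (∃; _×_; _,_; proj₁)
open import Data.Rational
  using (ℚ; mkℚ; 0ℚ; 1ℚ; _+_; _-_; -_; _/_; 1/_; NonZero; ≢-nonZero; nonNegative; nonPositive)
import Data.Rational.Properties as ℚ
open import Data.Rational.Solver using (module +-*-Solver)
open import Data.Sum using (inj₁; inj₂)
open import Data.Unit using (tt)
import Data.Vec.Functional as Vector
open import Function using (_∘_; id; Equivalence)
open import Relation.Binary using (tri<; tri≈; tri>)
open import Relation.Binary.PropositionalEquality
  using (_≡_; refl; sym; trans; cong; cong₂; subst; module ≡-Reasoning)
open import Relation.Nullary using (yes; no)

open +-*-Solver using (solve; _:+_; _:-_; _:*_; con; _:=_)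

cong₃ : ∀ {A B C D : Set} (f : A → B → C → D) {x x′ y y′ z z′} →
        x ≡ x′ → y ≡ y′ → z ≡ z′ → f x y z ≡ f x′ y′ z′
cong₃ f refl refl refl = refl

ℕ→ℚ≡mkℚ : ∀ k → ℕ→ℚ k ≡ mkℚ (+ k) 0 (Coprimality.sym (Coprimality.1-coprimeTo k))
ℕ→ℚ≡mkℚ k = ℚ.normalize-coprime (Coprimality.sym (Coprimality.1-coprimeTo k))

ℕ→ℚ-+ : ∀ m n → ℕ→ℚ (m ℕ.+ n) ≡ ℕ→ℚ m + ℕ→ℚ n
ℕ→ℚ-+ m n = sym (begin
  ℕ→ℚ m + ℕ→ℚ n                       ≡⟨ cong₂ _+_ (ℕ→ℚ≡mkℚ m) (ℕ→ℚ≡mkℚ n) ⟩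
  (+ m ℤ.* + 1 ℤ.+ + n ℤ.* + 1) / 1   ≡⟨ cong (_/ 1) (cong₂ ℤ._+_ (ℤ.*-identityʳ (+ m))
                                                                 (ℤ.*-identityʳ (+ n))) ⟩
  (+ m ℤ.+ + n) / 1                   ≡⟨ cong (_/ 1) (ℤ.pos-+ m n) ⟨
  ℕ→ℚ (m ℕ.+ n)                       ∎)
  where open ≡-Reasoning

ℕ→ℚ-* : ∀ m n → ℕ→ℚ (m ℕ.* n) ≡ ℕ→ℚ m * ℕ→ℚ n
ℕ→ℚ-* m n = sym (begin
  ℕ→ℚ m * ℕ→ℚ n      ≡⟨ cong₂ _*_ (ℕ→ℚ≡mkℚ m) (ℕ→ℚ≡mkℚ n) ⟩
  (+ m ℤ.* + n) / 1  ≡⟨ cong (_/ 1) (ℤ.pos-* m n) ⟨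
  ℕ→ℚ (m ℕ.* n)      ∎)
  where open ≡-Reasoning

ℕ→ℚ-nonNeg : ∀ k → 0ℚ ≤ ℕ→ℚ k
ℕ→ℚ-nonNeg k = ℚ.nonNegative⁻¹ (ℕ→ℚ k) {{ℚ.normalize-nonNeg k 1}}

p+r≡q⇒p≤q : ∀ {p q r} → 0ℚ ≤ r → p + r ≡ q → p ≤ q
p+r≡q⇒p≤q {p} 0≤r refl = ℚ.≤-trans (ℚ.≤-reflexive (sym (ℚ.+-identityʳ p))) (ℚ.+-monoʳ-≤ p 0≤r)

p≤q⇒0≤q-p : ∀ {p q} → p ≤ q → 0ℚ ≤ q - p
p≤q⇒0≤q-p {p} p≤q = ℚ.≤-trans (ℚ.≤-reflexive (sym (ℚ.+-inverseʳ p))) (ℚ.+-monoˡ-≤ (- p) p≤q)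

ℕ→ℚ-+-∸ : ∀ {m n} → m ℕ.≤ n → ℕ→ℚ m + ℕ→ℚ (n ℕ.∸ m) ≡ ℕ→ℚ n
ℕ→ℚ-+-∸ {m} {n} m≤n = trans (sym (ℕ→ℚ-+ m (n ℕ.∸ m))) (cong ℕ→ℚ (ℕ.m+[n∸m]≡n m≤n))

ℕ→ℚ-mono-≤ : ∀ {m n} → m ℕ.≤ n → ℕ→ℚ m ≤ ℕ→ℚ n
ℕ→ℚ-mono-≤ {m} {n} m≤n = p+r≡q⇒p≤q (ℕ→ℚ-nonNeg (n ℕ.∸ m)) (ℕ→ℚ-+-∸ m≤n)

*-nonNeg : ∀ {p q} → 0ℚ ≤ p → 0ℚ ≤ q → 0ℚ ≤ p * q
*-nonNeg {p} {q} 0≤p 0≤q =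
  ℚ.nonNegative⁻¹ (p * q) {{ℚ.nonNeg*nonNeg⇒nonNeg p {{nonNegative 0≤p}} q {{nonNegative 0≤q}}}}

square-nonNeg : ∀ p → 0ℚ ≤ p * p
square-nonNeg p with ℚ.≤-total 0ℚ p
... | inj₁ 0≤p = *-nonNeg 0≤p 0≤p
... | inj₂ p≤0 = ℚ.nonNegative⁻¹ (p * p) {{ℚ.nonPos*nonPos⇒nonPos p {{nonPositive p≤0}} p {{nonPositive p≤0}}}}

½-nonNeg : 0ℚ ≤ ½
½-nonNeg = ℚ.nonNegative⁻¹ ½

1/-nonNeg : ∀ p .{{p≢0 : NonZero p}} → 0ℚ ≤ p → 0ℚ ≤ 1/ p
1/-nonNeg p {{p≢0}} 0≤p = ℚ.nonNegative⁻¹ ((1/ p) {{p≢0}})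
  {{ℚ.pos⇒nonNeg ((1/ p) {{p≢0}}) {{ℚ.1/pos⇒pos p {{ℚ.nonNeg∧nonZero⇒pos p {{nonNegative 0≤p}} {{p≢0}}}}}}}}

-- 1 - (a j - a² j(j-1)/2).  Its nonnegativity needs j integral: at a = 1, j = 3/2 it is -1/8.
quadraticSlack : ℚ → ℚ → ℚ
quadraticSlack a j = 1ℚ - a * j + ½ * (a * a) * (j * j - j)

quadraticSlack-nonNeg : ∀ {a} → 0ℚ ≤ a → a ≤ 1ℚ → ∀ j → 0ℚ ≤ quadraticSlack a (ℕ→ℚ j)
quadraticSlack-nonNeg {a} _ _ 0 = begin
  0ℚ                    ≤⟨ ℕ→ℚ-nonNeg 1 ⟩
  1ℚ                    ≡⟨ solve 1 (λ a → con 1ℚ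
                             := con 1ℚ :- a :* con 0ℚ :+ con ½ :* (a :* a) :* (con 0ℚ :* con 0ℚ :- con 0ℚ))
                                   refl a ⟩
  quadraticSlack a 0ℚ   ∎
  where open ℚ.≤-Reasoning
quadraticSlack-nonNeg {a} _ a≤1 1 = begin
  0ℚ                    ≤⟨ p≤q⇒0≤q-p a≤1 ⟩
  1ℚ - a                ≡⟨ solve 1 (λ a → con 1ℚ :- a
                             := con 1ℚ :- a :* con 1ℚ :+ con ½ :* (a :* a) :* (con 1ℚ :* con 1ℚ :- con 1ℚ))
                                   refl a ⟩
  quadraticSlack a 1ℚ   ∎
  where open ℚ.≤-Reasoning
quadraticSlack-nonNeg {a} _ _ (ℕ.suc (ℕ.suc k)) = begin
  0ℚ
    ≤⟨ ℚ.+-mono-≤ (square-nonNeg (½ * a * j - 1ℚ)) rest-nonNeg ⟩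
  (½ * a * j - 1ℚ) * (½ * a * j - 1ℚ) + ½ * ½ * (a * a) * κ * j
    ≡⟨ cong (λ j → (½ * a * j - 1ℚ) * (½ * a * j - 1ℚ) + ½ * ½ * (a * a) * κ * j) (ℕ→ℚ-+ 2 k) ⟩
  (½ * a * (two + κ) - 1ℚ) * (½ * a * (two + κ) - 1ℚ) + ½ * ½ * (a * a) * κ * (two + κ)
    ≡⟨ complete-square a κ ⟩
  quadraticSlack a (two + κ)                            ≡⟨ cong (quadraticSlack a) (ℕ→ℚ-+ 2 k) ⟨
  quadraticSlack a j                                    ∎
  where
  open ℚ.≤-Reasoning
  two = ℕ→ℚ 2
  κ = ℕ→ℚ k
  j = ℕ→ℚ (2 ℕ.+ k)
  rest-nonNeg : 0ℚ ≤ ½ * ½ * (a * a) * κ * j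
  rest-nonNeg = *-nonNeg (*-nonNeg (*-nonNeg (*-nonNeg ½-nonNeg ½-nonNeg) (square-nonNeg a)) (ℕ→ℚ-nonNeg k))
                         (ℕ→ℚ-nonNeg (2 ℕ.+ k))
  complete-square : ∀ a κ → (½ * a * (two + κ) - 1ℚ) * (½ * a * (two + κ) - 1ℚ) + ½ * ½ * (a * a) * κ * (two + κ)
                            ≡ quadraticSlack a (two + κ)
  complete-square = solve 2 (λ a κ →
    (con ½ :* a :* (con two :+ κ) :- con 1ℚ) :* (con ½ :* a :* (con two :+ κ) :- con 1ℚ)
      :+ con ½ :* con ½ :* (a :* a) :* κ :* (con two :+ κ)
    := con 1ℚ :- a :* (con two :+ κ)
         :+ con ½ :* (a :* a) :* ((con two :+ κ) :* (con two :+ κ) :- (con two :+ κ))) refl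

vertexScore : ℚ → (A B T : ℕ) → ℚ
vertexScore a A B T = a * ℕ→ℚ A - a * a * ℕ→ℚ B - a * ℕ→ℚ T

vertexScore-≤1 : ∀ {a} → 0ℚ ≤ a → a ≤ 1ℚ → ∀ {A B T j} →
                 A ℕ.≤ T ℕ.+ j → j ℕ.* j ℕ.≤ 2 ℕ.* B ℕ.+ j → vertexScore a A B T ≤ 1ℚ
vertexScore-≤1 {a} 0≤a a≤1 {A} {B} {T} {j} A≤T+j j²≤2B+j = p+r≡q⇒p≤q slack-nonNeg (begin
  vertexScore a A B T + slack
    ≡⟨ regroup a A′ B′ T′ j′ s′ r′ ⟩
  1ℚ + a * ((A′ + s′) - (T′ + j′)) + ½ * (a * a) * ((j′ * j′ + r′) - (two * B′ + j′))
    ≡⟨ cong₂ (λ p q → 1ℚ + a * (p - (T′ + j′)) + ½ * (a * a) * (q - (two * B′ + j′))) eqA eqB ⟩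
  1ℚ + a * ((T′ + j′) - (T′ + j′)) + ½ * (a * a) * ((two * B′ + j′) - (two * B′ + j′))
    ≡⟨ solve 3 (λ a p q → con 1ℚ :+ a :* (p :- p) :+ con ½ :* (a :* a) :* (q :- q) := con 1ℚ)
               refl a (T′ + j′) (two * B′ + j′) ⟩
  1ℚ ∎)
  where
  open ≡-Reasoning
  A′ = ℕ→ℚ A ; B′ = ℕ→ℚ B ; T′ = ℕ→ℚ T ; j′ = ℕ→ℚ j ; two = ℕ→ℚ 2
  s′ = ℕ→ℚ (T ℕ.+ j ℕ.∸ A)
  r′ = ℕ→ℚ (2 ℕ.* B ℕ.+ j ℕ.∸ j ℕ.* j)
  slack = a * s′ + ½ * (a * a) * r′ + quadraticSlack a j′
  slack-nonNeg : 0ℚ ≤ slack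
  slack-nonNeg = ℚ.+-mono-≤
    (ℚ.+-mono-≤ (*-nonNeg 0≤a (ℕ→ℚ-nonNeg (T ℕ.+ j ℕ.∸ A)))
                (*-nonNeg (*-nonNeg ½-nonNeg (square-nonNeg a)) (ℕ→ℚ-nonNeg (2 ℕ.* B ℕ.+ j ℕ.∸ j ℕ.* j))))
    (quadraticSlack-nonNeg 0≤a a≤1 j)
  eqA : A′ + s′ ≡ T′ + j′
  eqA = trans (ℕ→ℚ-+-∸ A≤T+j) (ℕ→ℚ-+ T j)
  eqB : j′ * j′ + r′ ≡ two * B′ + j′
  eqB = begin
    j′ * j′ + r′              ≡⟨ cong (_+ r′) (ℕ→ℚ-* j j) ⟨
    ℕ→ℚ (j ℕ.* j) + r′        ≡⟨ ℕ→ℚ-+-∸ j²≤2B+j ⟩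
    ℕ→ℚ (2 ℕ.* B ℕ.+ j)       ≡⟨ ℕ→ℚ-+ (2 ℕ.* B) j ⟩
    ℕ→ℚ (2 ℕ.* B) + j′        ≡⟨ cong (_+ j′) (ℕ→ℚ-* 2 B) ⟩
    two * B′ + j′             ∎
  regroup : ∀ a A B T j s r → a * A - a * a * B - a * T + (a * s + ½ * (a * a) * r + quadraticSlack a j)
            ≡ 1ℚ + a * ((A + s) - (T + j)) + ½ * (a * a) * ((j * j + r) - (two * B + j))
  regroup = solve 7 (λ a A B T j s r →
    a :* A :- a :* a :* B :- a :* T
      :+ (a :* s :+ con ½ :* (a :* a) :* r :+ (con 1ℚ :- a :* j :+ con ½ :* (a :* a) :* (j :* j :- j)))
    := con 1ℚ :+ a :* ((A :+ s) :- (T :+ j)) :+ con ½ :* (a :* a) :* ((j :* j :+ r) :- (con two :* B :+ j))) refl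

vertexScore-≤0 : ∀ {a} → 0ℚ ≤ a → ∀ {A B T} → A ℕ.≤ T → vertexScore a A B T ≤ 0ℚ
vertexScore-≤0 {a} 0≤a {A} {B} {T} A≤T = p+r≡q⇒p≤q slack-nonNeg (begin
  vertexScore a A B T + slack      ≡⟨ regroup a A′ B′ T′ s′ ⟩
  a * ((A′ + s′) - T′)             ≡⟨ cong (λ p → a * (p - T′)) (ℕ→ℚ-+-∸ A≤T) ⟩
  a * (T′ - T′)                    ≡⟨ solve 2 (λ a p → a :* (p :- p) := con 0ℚ) refl a T′ ⟩
  0ℚ                               ∎)
  where
  open ≡-Reasoning
  A′ = ℕ→ℚ A ; B′ = ℕ→ℚ B ; T′ = ℕ→ℚ T
  s′ = ℕ→ℚ (T ℕ.∸ A)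
  slack = a * s′ + a * a * B′
  slack-nonNeg : 0ℚ ≤ slack
  slack-nonNeg = ℚ.+-mono-≤ (*-nonNeg 0≤a (ℕ→ℚ-nonNeg (T ℕ.∸ A))) (*-nonNeg (square-nonNeg a) (ℕ→ℚ-nonNeg B))
  regroup : ∀ a A B T s → a * A - a * a * B - a * T + (a * s + a * a * B) ≡ a * ((A + s) - T)
  regroup = solve 5 (λ a A B T s →
    a :* A :- a :* a :* B :- a :* T :+ (a :* s :+ a :* a :* B) := a :* ((A :+ s) :- T)) refl

foldr-tabulate : ∀ {A : Set} {m n} (_⊕_ : A → A → A) (e : A) (f : Fin m → A) (g : Fin n → Fin m) →
                 List.foldr (λ i acc → f i ⊕ acc) e (List.tabulate g) ≡ Vector.foldr _⊕_ e (f ∘ g)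
foldr-tabulate {n = ℕ.zero}  _⊕_ e f g = refl
foldr-tabulate {n = ℕ.suc n} _⊕_ e f g = cong (f (g fzero) ⊕_) (foldr-tabulate _⊕_ e f (g ∘ fsuc))

open SemiringSum ℕ.+-*-semiring
  using (sum; sum-cong-≗; sum-remove; sum-replicate-zero; ∑-distrib-+; ∑-comm; *-distribˡ-sum; *-distribʳ-sum)
module ℚΣ = SemiringSum (Ring.semiring ℚ.+-*-ring)

Σℕ≡sum : ∀ {n} (f : Fin n → ℕ) → Σℕ f ≡ sum f
Σℕ≡sum f = foldr-tabulate ℕ._+_ 0 f id

Σℚ≡sum : ∀ {n} (f : Fin n → ℚ) → Σℚ f ≡ ℚΣ.sum f
Σℚ≡sum f = foldr-tabulate _+_ 0ℚ f id

sum-mono-≤ : ∀ {n} {f g : Fin n → ℕ} → (∀ i → f i ℕ.≤ g i) → sum f ℕ.≤ sum g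
sum-mono-≤ {ℕ.zero}  f≤g = ℕ.z≤n
sum-mono-≤ {ℕ.suc n} f≤g = ℕ.+-mono-≤ (f≤g fzero) (sum-mono-≤ (f≤g ∘ fsuc))

term-≤-sum : ∀ {n} (f : Fin n → ℕ) i → f i ℕ.≤ sum f
term-≤-sum {ℕ.suc n} f i = ℕ.≤-trans (ℕ.m≤m+n (f i) _) (ℕ.≤-reflexive (sym (sum-remove f)))

ℚsum-mono-≤ : ∀ {n} {f g : Fin n → ℚ} → (∀ i → f i ≤ g i) → ℚΣ.sum f ≤ ℚΣ.sum g
ℚsum-mono-≤ {ℕ.zero}  f≤g = ℚ.≤-refl
ℚsum-mono-≤ {ℕ.suc n} f≤g = ℚ.+-mono-≤ (f≤g fzero) (ℚsum-mono-≤ (f≤g ∘ fsuc))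

ℚsum-nonNeg : ∀ {n} {f : Fin n → ℚ} → (∀ i → 0ℚ ≤ f i) → 0ℚ ≤ ℚΣ.sum f
ℚsum-nonNeg {n} 0≤f = ℚ.≤-trans (ℚ.≤-reflexive (sym (ℚΣ.sum-replicate-zero n))) (ℚsum-mono-≤ 0≤f)

ℚsum-ℕ→ℚ : ∀ {n} (f : Fin n → ℕ) → ℚΣ.sum (ℕ→ℚ ∘ f) ≡ ℕ→ℚ (sum f)
ℚsum-ℕ→ℚ {ℕ.zero}  f = refl
ℚsum-ℕ→ℚ {ℕ.suc n} f = trans (cong (λ q → ℕ→ℚ (f fzero) + q) (ℚsum-ℕ→ℚ (f ∘ fsuc))) (sym (ℕ→ℚ-+ (f fzero) _))

b2ℕ-∧ : ∀ b c → b2ℕ (b ∧ c) ≡ b2ℕ b ℕ.* b2ℕ c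
b2ℕ-∧ true  c = sym (ℕ.*-identityˡ (b2ℕ c))
b2ℕ-∧ false c = refl

b2ℕ-idem : ∀ b → b2ℕ b ℕ.* b2ℕ b ≡ b2ℕ b
b2ℕ-idem true  = refl
b2ℕ-idem false = refl

b2ℕ-mono : ∀ {b c} → (T b → T c) → b2ℕ b ℕ.≤ b2ℕ c
b2ℕ-mono {false}         _ = ℕ.z≤n
b2ℕ-mono {true} {true}  _ = ℕ.≤-refl
b2ℕ-mono {true} {false} b⇒c = ⊥-elim (b⇒c tt)

T-∧⁻ : ∀ {b c} → T (b ∧ c) → T b × T c
T-∧⁻ = Equivalence.to T-∧

T-∧⁺ : ∀ {b c} → T b → T c → T (b ∧ c)
T-∧⁺ tb tc = Equivalence.from T-∧ (tb , tc)

T-∨⁺ˡ : ∀ {b c} → T b → T (b ∨ c)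
T-∨⁺ˡ tb = Equivalence.from T-∨ (inj₁ tb)

T-∨⁺ʳ : ∀ {b c} → T c → T (b ∨ c)
T-∨⁺ʳ tc = Equivalence.from T-∨ (inj₂ tc)

count : ∀ {n} → (Fin n → Bool) → ℕ
count y = sum (b2ℕ ∘ y)

orderedPairs : ∀ {n} → (Fin n → Bool) → ℕ
orderedPairs y = sum λ i → sum λ k → b2ℕ (y i ∧ y k ∧ (i <ᵛ k))

orderedPairs-suc : ∀ {n} (y : Fin (ℕ.suc n) → Bool) →
                   orderedPairs y ≡ b2ℕ (y fzero) ℕ.* count (y ∘ fsuc) ℕ.+ orderedPairs (y ∘ fsuc)
orderedPairs-suc y = cong₂ ℕ._+_ firstRow (sum-cong-≗ laterRow)
  where
  y₀ = y fzero
  firstRow : b2ℕ (y₀ ∧ y₀ ∧ false) ℕ.+ sum (λ k → b2ℕ (y₀ ∧ y (fsuc k) ∧ true)) ≡ b2ℕ y₀ ℕ.* count (y ∘ fsuc)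
  firstRow = begin
    b2ℕ (y₀ ∧ y₀ ∧ false) ℕ.+ sum (λ k → b2ℕ (y₀ ∧ y (fsuc k) ∧ true))
      ≡⟨ cong₂ ℕ._+_ (cong (λ b → b2ℕ (y₀ ∧ b)) (∧-zeroʳ y₀))
                     (sum-cong-≗ λ k → cong (λ b → b2ℕ (y₀ ∧ b)) (∧-identityʳ (y (fsuc k)))) ⟩
    b2ℕ (y₀ ∧ false) ℕ.+ sum (λ k → b2ℕ (y₀ ∧ y (fsuc k)))
      ≡⟨ cong₂ ℕ._+_ (cong b2ℕ (∧-zeroʳ y₀)) (sum-cong-≗ λ k → b2ℕ-∧ y₀ (y (fsuc k))) ⟩
    sum (λ k → b2ℕ y₀ ℕ.* b2ℕ (y (fsuc k)))
      ≡⟨ *-distribˡ-sum (b2ℕ y₀) (b2ℕ ∘ y ∘ fsuc) ⟨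
    b2ℕ y₀ ℕ.* count (y ∘ fsuc) ∎
    where open ≡-Reasoning
  laterRow : ∀ i → b2ℕ (y (fsuc i) ∧ y₀ ∧ false) ℕ.+ sum (λ k → b2ℕ (y (fsuc i) ∧ y (fsuc k) ∧ (i <ᵛ k)))
                 ≡ sum (λ k → b2ℕ (y (fsuc i) ∧ y (fsuc k) ∧ (i <ᵛ k)))
  laterRow i = cong (λ b → b2ℕ b ℕ.+ sum (λ k → b2ℕ (y (fsuc i) ∧ y (fsuc k) ∧ (i <ᵛ k))))
                    (trans (cong (y (fsuc i) ∧_) (∧-zeroʳ y₀)) (∧-zeroʳ (y (fsuc i))))

count-square : ∀ {n} (y : Fin n → Bool) → count y ℕ.* count y ≡ 2 ℕ.* orderedPairs y ℕ.+ count y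
count-square {ℕ.zero}  y = refl
count-square {ℕ.suc n} y = begin
  (c ℕ.+ s) ℕ.* (c ℕ.+ s)                        ≡⟨ expand c s ⟩
  c ℕ.* c ℕ.+ 2 ℕ.* (c ℕ.* s) ℕ.+ s ℕ.* s        ≡⟨ cong₂ (λ p q → p ℕ.+ 2 ℕ.* (c ℕ.* s) ℕ.+ q)
                                                         (b2ℕ-idem (y fzero)) (count-square (y ∘ fsuc)) ⟩
  c ℕ.+ 2 ℕ.* (c ℕ.* s) ℕ.+ (2 ℕ.* P ℕ.+ s)      ≡⟨ regroup c s P ⟩
  2 ℕ.* (c ℕ.* s ℕ.+ P) ℕ.+ (c ℕ.+ s)            ≡⟨ cong (λ p → 2 ℕ.* p ℕ.+ (c ℕ.+ s)) (orderedPairs-suc y) ⟨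
  2 ℕ.* orderedPairs y ℕ.+ (c ℕ.+ s)             ∎
  where
  open ≡-Reasoning
  c = b2ℕ (y fzero)
  s = count (y ∘ fsuc)
  P = orderedPairs (y ∘ fsuc)
  expand : ∀ c s → (c ℕ.+ s) ℕ.* (c ℕ.+ s) ≡ c ℕ.* c ℕ.+ 2 ℕ.* (c ℕ.* s) ℕ.+ s ℕ.* s
  expand = solve-∀
  regroup : ∀ c s P → c ℕ.+ 2 ℕ.* (c ℕ.* s) ℕ.+ (2 ℕ.* P ℕ.+ s) ≡ 2 ℕ.* (c ℕ.* s ℕ.+ P) ℕ.+ (c ℕ.+ s)
  regroup = solve-∀

orderedPairs-mono : ∀ {n} {y z : Fin n → Bool} → (∀ i → T (y i) → T (z i)) → orderedPairs y ℕ.≤ orderedPairs z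
orderedPairs-mono {y = y} {z} y⊆z = sum-mono-≤ λ i → sum-mono-≤ λ k → b2ℕ-mono (pair i k)
  where
  pair : ∀ i k → T (y i ∧ y k ∧ (i <ᵛ k)) → T (z i ∧ z k ∧ (i <ᵛ k))
  pair i k t with T-∧⁻ {y i} t
  ... | yᵢ , rest with T-∧⁻ {y k} rest
  ...   | yₖ , i<k = T-∧⁺ {z i} (y⊆z i yᵢ) (T-∧⁺ {z k} (y⊆z k yₖ) i<k)

any-allFin⁺ : ∀ {n} (p : Fin n → Bool) i → T (p i) → T (any p (allFin n))
any-allFin⁺ p i pᵢ = any⁺ p (lose (∈-allFin i) pᵢ)

any-allFin⁻ : ∀ {n} (p : Fin n → Bool) → T (any p (allFin n)) → ∃ λ i → T (p i)
any-allFin⁻ p = satisfied ∘ any⁻ p (allFin _)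

count≡0 : ∀ {n} (p : Fin n → Bool) → any p (allFin n) ≡ false → count p ≡ 0
count≡0 {n} p none = trans (sum-cong-≗ p≡false) (sum-replicate-zero n)
  where
  p≡false : ∀ i → b2ℕ (p i) ≡ 0
  p≡false i with p i in pᵢ
  ... | false = refl
  ... | true  = ⊥-elim (subst T none (any-allFin⁺ p i (Equivalence.from T-≡ pᵢ)))

Σℚ-indicator : ∀ {n} (b c : Fin n → Bool) →
               Σℚ (λ i → if b i then b2ℚ (c i) else 0ℚ) ≡ ℕ→ℚ (sum λ i → b2ℕ (b i ∧ c i))
Σℚ-indicator b c = trans (Σℚ≡sum (λ i → if b i then b2ℚ (c i) else 0ℚ))
                         (trans (ℚΣ.sum-cong-≗ λ i → if-b2ℚ (b i) (c i)) (ℚsum-ℕ→ℚ (λ i → b2ℕ (b i ∧ c i))))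
  where
  if-b2ℚ : ∀ b c → (if b then b2ℚ c else 0ℚ) ≡ ℕ→ℚ (b2ℕ (b ∧ c))
  if-b2ℚ true  c = refl
  if-b2ℚ false c = refl

Σℚ-indicator₂ : ∀ {m n} (b c : Fin m → Fin n → Bool) →
                Σℚ (λ i → Σℚ (λ k → if b i k then b2ℚ (c i k) else 0ℚ))
                ≡ ℕ→ℚ (sum λ i → sum λ k → b2ℕ (b i k ∧ c i k))
Σℚ-indicator₂ b c = trans (Σℚ≡sum (λ i → Σℚ (λ k → if b i k then b2ℚ (c i k) else 0ℚ)))
                          (trans (ℚΣ.sum-cong-≗ λ i → Σℚ-indicator (b i) (c i))
                                 (ℚsum-ℕ→ℚ (λ i → sum λ k → b2ℕ (b i k ∧ c i k))))

module _ {n : ℕ} (Γ : SimpleGraph n) where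

  adjacentTo : (Fin n → Bool) → Fin n → Bool
  adjacentTo I v = any (λ u → adj Γ v u ∧ I u) (allFin n)

  edgeMeets : (Fin n → Bool) → Fin n → Fin n → Bool
  edgeMeets J u v = adj Γ u v ∧ (u <ᵛ v) ∧ (J u ∨ J v)

  edgesMeeting : (Fin n → Bool) → ℕ
  edgesMeeting J = sum λ u → sum λ v → b2ℕ (edgeMeets J u v)

  H≡edgesMeeting : ∀ I → H Γ I ≡ edgesMeeting (inIN Γ I)
  H≡edgesMeeting I = trans (Σℕ≡sum (λ u → Σℕ (meets u))) (sum-cong-≗ λ u → Σℕ≡sum (meets u))
    where
    meets : Fin n → Fin n → ℕ
    meets u v = b2ℕ (edgeMeets (inIN Γ I) u v)

  adj∧-≤-edgeMeets : ∀ J v w → b2ℕ (adj Γ v w ∧ J v) ℕ.≤ b2ℕ (edgeMeets J v w) ℕ.+ b2ℕ (edgeMeets J w v)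
  adj∧-≤-edgeMeets J v w with ℕ.<-cmp (toℕ v) (toℕ w)
  ... | tri< v<w _ _ = ℕ.≤-trans (b2ℕ-mono meets) (ℕ.m≤m+n _ _)
    where
    meets : T (adj Γ v w ∧ J v) → T (edgeMeets J v w)
    meets t with T-∧⁻ {adj Γ v w} t
    ... | vw , Jv = T-∧⁺ {adj Γ v w} vw (T-∧⁺ {v <ᵛ w} (ℕ.<⇒<ᵇ v<w) (T-∨⁺ˡ {J v} Jv))
  ... | tri≈ _ v≡w _ = ℕ.≤-trans (b2ℕ-mono loop) ℕ.z≤n
    where
    loop : T (adj Γ v w ∧ J v) → T false
    loop t = subst T (trans (cong (adj Γ v) (sym (Fin.toℕ-injective v≡w))) (irrfl Γ v))
                     (proj₁ (T-∧⁻ {adj Γ v w} t))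
  ... | tri> _ _ w<v = ℕ.≤-trans (b2ℕ-mono meets) (ℕ.m≤n+m _ _)
    where
    meets : T (adj Γ v w ∧ J v) → T (edgeMeets J w v)
    meets t with T-∧⁻ {adj Γ v w} t
    ... | vw , Jv = T-∧⁺ {adj Γ w v} (subst T (SimpleGraph.sym Γ v w) vw)
                         (T-∧⁺ {w <ᵛ v} (ℕ.<⇒<ᵇ w<v) (T-∨⁺ʳ {J w} Jv))

  degreeSum-≤-2·edgesMeeting : ∀ J → sum (λ v → deg Γ v ℕ.* b2ℕ (J v)) ℕ.≤ 2 ℕ.* edgesMeeting J
  degreeSum-≤-2·edgesMeeting J = begin
    sum (λ v → deg Γ v ℕ.* b2ℕ (J v))
      ≡⟨ sum-cong-≗ (λ v → trans (cong (ℕ._* b2ℕ (J v)) (Σℕ≡sum (b2ℕ ∘ adj Γ v)))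
                                 (*-distribʳ-sum (b2ℕ (J v)) (b2ℕ ∘ adj Γ v))) ⟩
    sum (λ v → sum (λ w → b2ℕ (adj Γ v w) ℕ.* b2ℕ (J v)))
      ≤⟨ sum-mono-≤ (λ v → sum-mono-≤ (λ w → ℕ.≤-trans (ℕ.≤-reflexive (sym (b2ℕ-∧ (adj Γ v w) (J v))))
                                                         (adj∧-≤-edgeMeets J v w))) ⟩
    sum (λ v → sum (λ w → m v w ℕ.+ m w v))
      ≡⟨ sum-cong-≗ (λ v → ∑-distrib-+ (m v) (λ w → m w v)) ⟩
    sum (λ v → sum (m v) ℕ.+ sum (λ w → m w v))
      ≡⟨ ∑-distrib-+ (λ v → sum (m v)) (λ v → sum (λ w → m w v)) ⟩
    E ℕ.+ sum (λ v → sum (λ w → m w v))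
      ≡⟨ cong (E ℕ.+_) (∑-comm m) ⟨
    E ℕ.+ E
      ≡⟨ cong (E ℕ.+_) (ℕ.+-identityʳ E) ⟨
    2 ℕ.* E ∎
    where
    open ℕ.≤-Reasoning
    m : Fin n → Fin n → ℕ
    m u v = b2ℕ (edgeMeets J u v)
    E = edgesMeeting J

  invDeg-nonNeg : ∀ w → 0ℚ ≤ invDeg Γ w
  invDeg-nonNeg w with deg Γ w
  ... | ℕ.zero  = ℚ.≤-refl
  ... | ℕ.suc k = ℚ.nonNegative⁻¹ _ {{ℚ.normalize-nonNeg 1 (ℕ.suc k)}}

  Gsum-nonNeg : ∀ v → 0ℚ ≤ Gsum Γ v
  Gsum-nonNeg v = ℚ.≤-trans (ℚsum-nonNeg term-nonNeg) (ℚ.≤-reflexive (sym (Σℚ≡sum term)))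
    where
    term : Fin n → ℚ
    term w = if adj Γ v w then invDeg Γ w else 0ℚ
    term-nonNeg : ∀ w → 0ℚ ≤ term w
    term-nonNeg w with adj Γ v w
    ... | true  = invDeg-nonNeg w
    ... | false = ℚ.≤-refl

  aCoef-nonNeg : ∀ v → 0ℚ ≤ aCoef Γ v
  aCoef-nonNeg v with Gsum Γ v ℚ.≟ 0ℚ
  ... | yes _   = ℕ→ℚ-nonNeg 1
  ... | no  G≢0 = ℚ.⊓-glb (ℕ→ℚ-nonNeg 1) (1/-nonNeg (Gsum Γ v) {{≢-nonZero G≢0}} (Gsum-nonNeg v))

  aCoef-≤1 : ∀ v → aCoef Γ v ≤ 1ℚ
  aCoef-≤1 v with Gsum Γ v ℚ.≟ 0ℚ
  ... | yes _   = ℚ.≤-refl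
  ... | no  G≢0 = ℚ.p⊓q≤p 1ℚ ((1/ Gsum Γ v) {{≢-nonZero G≢0}})

  module _ (X : Fin n → Bool) where

    higherMarkedNeighbour : Fin n → Fin n → Bool
    higherMarkedNeighbour w u = adj Γ w u ∧ (w <ᵛ u) ∧ X u

    marked-≤-higherMarked+inIX : ∀ w →
      b2ℕ (X w) ℕ.≤ sum (λ u → b2ℕ ((adj Γ w u ∧ (w <ᵛ u)) ∧ (X w ∧ X u))) ℕ.+ b2ℕ (inIX Γ X w)
    marked-≤-higherMarked+inIX w with X w | any (higherMarkedNeighbour w) (allFin n) in dominated
    ... | false | _ = ℕ.z≤n
    ... | true | false = ℕ.m≤n+m 1 _
    ... | true | true with any-allFin⁻ (higherMarkedNeighbour w) (subst T (sym dominated) tt)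
    ...   | u , wu = ℕ.≤-trans (ℕ.≤-trans (b2ℕ-mono {c = (adj Γ w u ∧ (w <ᵛ u)) ∧ X u} reassoc) (term-≤-sum _ u))
                               (ℕ.m≤m+n _ _)
      where
      reassoc : T true → T ((adj Γ w u ∧ (w <ᵛ u)) ∧ X u)
      reassoc _ = subst T (sym (∧-assoc (adj Γ w u) (w <ᵛ u) (X u))) wu

    inIX⇒marked : ∀ w → T (inIX Γ X w) → T (X w)
    inIX⇒marked w = proj₁ ∘ T-∧⁻ {X w}

    markedNeighbours : Fin n → ℕ
    markedNeighbours v = count λ w → adj Γ v w ∧ X w

    markedNeighbourPairs : Fin n → ℕ
    markedNeighbourPairs v = orderedPairs λ w → adj Γ v w ∧ X w

    markedUpwardEdges : Fin n → ℕ
    markedUpwardEdges v = sum λ w → sum λ u → b2ℕ ((adj Γ v w ∧ adj Γ w u ∧ (w <ᵛ u)) ∧ (X w ∧ X u))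

    neighboursInIX : Fin n → ℕ
    neighboursInIX v = count λ w → adj Γ v w ∧ inIX Γ X w

    Sv≡vertexScore : ∀ v →
      Sv Γ X v ≡ vertexScore (aCoef Γ v) (markedNeighbours v) (markedNeighbourPairs v) (markedUpwardEdges v)
    Sv≡vertexScore v = cong₃ (λ A B U → a * A - a * a * B - a * U)
      (Σℚ-indicator (adj Γ v) X)
      (trans (Σℚ-indicator₂ (λ w w′ → adj Γ v w ∧ adj Γ v w′ ∧ (w <ᵛ w′)) (λ w w′ → X w ∧ X w′))
             (cong ℕ→ℚ (sum-cong-≗ λ w → sum-cong-≗ λ w′ →
                cong b2ℕ (shuffle (adj Γ v w) (X w) (adj Γ v w′) (X w′) (w <ᵛ w′)))))
      (Σℚ-indicator₂ (λ w u → adj Γ v w ∧ adj Γ w u ∧ (w <ᵛ u)) (λ w u → X w ∧ X u))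
      where
      a = aCoef Γ v
      open CommutativeMonoidSolver ∧-commutativeMonoid using (_⊕_; _⊜_) renaming (solve to solve-∧)
      shuffle : ∀ a x a′ x′ o → (a ∧ a′ ∧ o) ∧ (x ∧ x′) ≡ (a ∧ x) ∧ (a′ ∧ x′) ∧ o
      shuffle = solve-∧ 5 (λ a x a′ x′ o → (a ⊕ (a′ ⊕ o)) ⊕ (x ⊕ x′) ⊜ (a ⊕ x) ⊕ ((a′ ⊕ x′) ⊕ o)) refl

    markedNeighbours-≤ : ∀ v → markedNeighbours v ℕ.≤ markedUpwardEdges v ℕ.+ neighboursInIX v
    markedNeighbours-≤ v = ℕ.≤-trans (sum-mono-≤ marked-nbr)
                                     (ℕ.≤-reflexive (∑-distrib-+ upward (b2ℕ ∘ λ w → adj Γ v w ∧ inIX Γ X w)))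
      where
      upward : Fin n → ℕ
      upward w = sum λ u → b2ℕ ((adj Γ v w ∧ adj Γ w u ∧ (w <ᵛ u)) ∧ (X w ∧ X u))
      marked-nbr : ∀ w → b2ℕ (adj Γ v w ∧ X w) ℕ.≤ upward w ℕ.+ b2ℕ (adj Γ v w ∧ inIX Γ X w)
      marked-nbr w with adj Γ v w
      ... | true  = marked-≤-higherMarked+inIX w
      ... | false = ℕ.z≤n

    neighboursInIX-square-≤ : ∀ v →
      neighboursInIX v ℕ.* neighboursInIX v ℕ.≤ 2 ℕ.* markedNeighbourPairs v ℕ.+ neighboursInIX v
    neighboursInIX-square-≤ v = begin
      j ℕ.* j
        ≡⟨ count-square (λ w → adj Γ v w ∧ inIX Γ X w) ⟩
      2 ℕ.* orderedPairs (λ w → adj Γ v w ∧ inIX Γ X w) ℕ.+ j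
        ≤⟨ ℕ.+-monoˡ-≤ j (ℕ.*-monoʳ-≤ 2 (orderedPairs-mono IXNeighbour⇒markedNeighbour)) ⟩
      2 ℕ.* markedNeighbourPairs v ℕ.+ j
        ∎
      where
      open ℕ.≤-Reasoning
      j = neighboursInIX v
      IXNeighbour⇒markedNeighbour : ∀ w → T (adj Γ v w ∧ inIX Γ X w) → T (adj Γ v w ∧ X w)
      IXNeighbour⇒markedNeighbour w t with T-∧⁻ {adj Γ v w} t
      ... | vw , Iw = T-∧⁺ {adj Γ v w} vw (inIX⇒marked w Iw)

    Sv-≤-adjacentTo-IX : ∀ v → Sv Γ X v ≤ b2ℚ (adjacentTo (inIX Γ X) v)
    Sv-≤-adjacentTo-IX v = ℚ.≤-trans (ℚ.≤-reflexive (Sv≡vertexScore v)) (score-≤ _ refl)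
      where
      a = aCoef Γ v ; A = markedNeighbours v ; B = markedNeighbourPairs v ; U = markedUpwardEdges v
      j = neighboursInIX v
      score-≤ : ∀ b → adjacentTo (inIX Γ X) v ≡ b → vertexScore a A B U ≤ b2ℚ b
      score-≤ true  _ =
        vertexScore-≤1 (aCoef-nonNeg v) (aCoef-≤1 v) {A} {B} {U} {j}
                       (markedNeighbours-≤ v) (neighboursInIX-square-≤ v)
      score-≤ false isolated = vertexScore-≤0 (aCoef-nonNeg v) {A} {B} {U} A≤U
        where
        A≤U : A ℕ.≤ U
        A≤U = subst (A ℕ.≤_)
                    (trans (cong (U ℕ.+_) (count≡0 (λ u → adj Γ v u ∧ inIX Γ X u) isolated)) (ℕ.+-identityʳ U))
                    (markedNeighbours-≤ v)

    S-≤-degreeSum : S Γ X ≤ ℕ→ℚ (sum λ v → deg Γ v ℕ.* b2ℕ (inIN Γ (inIX Γ X) v))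
    S-≤-degreeSum = begin
      S Γ X                                         ≡⟨ Σℚ≡sum (λ v → ℕ→ℚ (deg Γ v) * Sv Γ X v) ⟩
      ℚΣ.sum (λ v → ℕ→ℚ (deg Γ v) * Sv Γ X v)       ≤⟨ ℚsum-mono-≤ weighted ⟩
      ℚΣ.sum (λ v → ℕ→ℚ (deg Γ v) * b2ℚ (J v))      ≡⟨ ℚΣ.sum-cong-≗ (λ v → ℕ→ℚ-* (deg Γ v) (b2ℕ (J v))) ⟨
      ℚΣ.sum (λ v → ℕ→ℚ (deg Γ v ℕ.* b2ℕ (J v)))    ≡⟨ ℚsum-ℕ→ℚ (λ v → deg Γ v ℕ.* b2ℕ (J v)) ⟩
      ℕ→ℚ (sum λ v → deg Γ v ℕ.* b2ℕ (J v))         ∎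
      where
      open ℚ.≤-Reasoning
      J = inIN Γ (inIX Γ X)
      weighted : ∀ v → ℕ→ℚ (deg Γ v) * Sv Γ X v ≤ ℕ→ℚ (deg Γ v) * b2ℚ (J v)
      weighted v = ℚ.*-monoˡ-≤-nonNeg (ℕ→ℚ (deg Γ v)) {{nonNegative (ℕ→ℚ-nonNeg (deg Γ v))}}
                     (ℚ.≤-trans (Sv-≤-adjacentTo-IX v) (ℕ→ℚ-mono-≤ (b2ℕ-mono (T-∨⁺ʳ {inIX Γ X v}))))

mainTheorem6 : ∀ {n : ℕ} (Γ : SimpleGraph n)
    → (∀ (u v : Fin n) → u < v → deg Γ u Data.Nat.≤ deg Γ v)
    → (X : Fin n → Bool)
    → S Γ X * ½ ≤ ℕ→ℚ (H Γ (inIX Γ X))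
mainTheorem6 Γ _ X = begin
  S Γ X * ½                                     ≤⟨ ℚ.*-monoʳ-≤-nonNeg ½ (S-≤-degreeSum Γ X) ⟩
  ℕ→ℚ (sum λ v → deg Γ v ℕ.* b2ℕ (J v)) * ½    ≤⟨ ℚ.*-monoʳ-≤-nonNeg ½ (ℕ→ℚ-mono-≤ (degreeSum-≤-2·edgesMeeting Γ J)) ⟩
  ℕ→ℚ (2 ℕ.* E) * ½                             ≡⟨ cong (_* ½) (ℕ→ℚ-* 2 E) ⟩
  ℕ→ℚ 2 * ℕ→ℚ E * ½                             ≡⟨ solve 1 (λ e → con (ℕ→ℚ 2) :* e :* con ½ := e) refl (ℕ→ℚ E) ⟩
  ℕ→ℚ E                                         ≡⟨ cong ℕ→ℚ (H≡edgesMeeting Γ (inIX Γ X)) ⟨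
  ℕ→ℚ (H Γ (inIX Γ X))                          ∎
  where
  open ℚ.≤-Reasoning
  J = inIN Γ (inIX Γ X)
  E = edgesMeeting Γ J
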